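{- Let $G$ be a finite bipartite graph on the vertex set $\Sigma_1=\{0,1,\dots,N-1\}$ with nonempty bipartition classes $V_1,V_2$, and let $G_n$ be the graph on $\Sigma_n=\Sigma_1^n$ described in the context. Let $\mathcal G$ be the directed graph described in the context and $\mathcal P_n$ the set of its directed paths with $n$ vertices. Identify a sequence $(v_1,\dots,v_n)$ of vertices of $\mathcal G$ with $v_i=(x_i,y_i)$ with the ordered pair of words $\big((x_1\dots x_n),(y_1\dots y_n)\big)\in\Sigma_n\times\Sigma_n$. Then, for every $n\ge 1$, under this identification $$E(G_n)=\mathcal P_n,$$ where $E(G_n)\subset \Sigma_n\times\Sigma_n$ is the set of ordered pairs $(\underline x,\underline y)$ such that $\underline x=\underline y$ or $\underline x,\underline y$ are adjacent in $G_n$.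
   Context: Let $E(G)$ be the edge set of $G$; every edge joins a vertex of $V_1$ to a vertex of $V_2$. For $x\in\Sigma_1$ set $\mathrm{typ}(x)=i$ if $x\in V_i$. For a word $\underline z=(z_1\dots z_m)$ over $\Sigma_1$, $\mathrm{typ}(\underline z)=i$ if all $z_j\in V_i$ ($i=1,2$), and $\mathrm{typ}(\underline z)=0$ otherwise. For distinct $\underline x,\underline y\in\Sigma_n$, $\underline x\wedge\underline y$ denotes their longest common prefix, $k=|\underline x\wedge\underline y|$, and the postfixes $\tilde{\underline x},\tilde{\underline y}\in\Sigma_{n-k}$ are defined by $\underline x=(\underline x\wedge\underline y)\tilde{\underline x}$, $\underline y=(\underline x\wedge\underline y)\tilde{\underline y}$. The graph $G_n$ has vertex set $\Sigma_n$; every vertex carries a loop, and two distinct vertices $\underline x,\underline y$ are adjacent iff $\{\mathrm{typ}(\tilde{\underline x}),\mathrm{typ}(\tilde{\underline y})\}=\{1,2\}$ and $\{x_i,y_i\}\in E(G)$ for every $i$ with $k<i\le n$. The directed graph $\mathcal G$ has vertex set $V_{dd}\cup V_{12}\cup V_{21}$, where $V_{dd}=\{(z,z):z\in\Sigma_1\}$, $V_{12}=\{(x,y): x\in V_1,\ y\in V_2,\ \{x,y\}\in E(G)\}$, $V_{21}=\{(x,y): x\in V_2,\ y\in V_1,\ \{x,y\}\in E(G)\}$. Its directed edges are: all ordered pairs $(u,w)$ with $u,w$ in the same one of the three sets $V_{dd},V_{12},V_{21}$ (loops included), and all ordered pairs $(u,w)$ with $u\in V_{dd}$ and $w\in V_{12}\cup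 V_{21}$. $\mathcal P_n$ is the set of sequences $(v_1,\dots,v_n)$ of vertices of $\mathcal G$ such that $(v_i,v_{i+1})$ is a directed edge for all $1\le i<n$. -}

module Defs where

open import Data.Nat using (ℕ)
open import Data.Fin using (Fin; _≟_)
open import Data.Bool using (Bool; true; false; _∧_; if_then_else_)
open import Data.List using (List; []; _∷_; length; drop; zip)
open import Data.List.Relation.Binary.Pointwise using (Pointwise)
open import Data.Product using (_×_; _,_)
open import Data.Sum using (_⊎_)
open import Data.Unit using (⊤)
open import Relation.Binary.PropositionalEquality using (_≡_; _≢_)
open import Relation.Nullary using (yes; no)

-- The two bipartition classes V₁, V₂ of G are encoded by a function
-- side : Fin N → Side  (x ∈ V₁ iff side x ≡ s₁, x ∈ V₂ iff side x ≡ s₂).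
data Side : Set where
  s₁ s₂ : Side

sideEq : Side → Side → Bool
sideEq s₁ s₁ = true
sideEq s₂ s₂ = true
sideEq _  _  = false

data Typ : Set where
  t₀ t₁ t₂ : Typ

module _ {N : ℕ} (side : Fin N → Side) where

  allIn : Side → List (Fin N) → Bool
  allIn s []       = true
  allIn s (z ∷ zs) = sideEq (side z) s ∧ allIn s zs

  typ : List (Fin N) → Typ
  typ zs = if allIn s₁ zs then t₁ else (if allIn s₂ zs then t₂ else t₀)

lcp : {N : ℕ} → List (Fin N) → List (Fin N) → List (Fin N)
lcp (a ∷ as) (b ∷ bs) with a ≟ b
... | yes _ = a ∷ lcp as bs
... | no  _ = []
lcp _ _ = []

module _ {N : ℕ} (side : Fin N → Side) (Adj : Fin N → Fin N → Set) where

  postfixL : List (Fin N) → List (Fin N) → List (Fin N)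
  postfixL xs ys = drop (length (lcp xs ys)) xs

  postfixR : List (Fin N) → List (Fin N) → List (Fin N)
  postfixR xs ys = drop (length (lcp xs ys)) ys

  AdjGn : List (Fin N) → List (Fin N) → Set
  AdjGn xs ys =
    xs ≢ ys ×
    (((typ side (postfixL xs ys) ≡ t₁) × (typ side (postfixR xs ys) ≡ t₂))
      ⊎ ((typ side (postfixL xs ys) ≡ t₂) × (typ side (postfixR xs ys) ≡ t₁))) ×
    Pointwise Adj (postfixL xs ys) (postfixR xs ys)

  EGn : List (Fin N) → List (Fin N) → Set
  EGn xs ys = xs ≡ ys ⊎ AdjGn xs ys

  InDD : Fin N × Fin N → Set
  InDD (x , y) = x ≡ y

  In12 : Fin N × Fin N → Set
  In12 (x , y) = side x ≡ s₁ × side y ≡ s₂ × Adj x y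

  In21 : Fin N × Fin N → Set
  In21 (x , y) = side x ≡ s₂ × side y ≡ s₁ × Adj x y

  Vertex𝒢 : Fin N × Fin N → Set
  Vertex𝒢 v = InDD v ⊎ In12 v ⊎ In21 v

  Edge𝒢 : Fin N × Fin N → Fin N × Fin N → Set
  Edge𝒢 u w = (InDD u × InDD w) ⊎ (In12 u × In12 w) ⊎ (In21 u × In21 w)
              ⊎ (InDD u × (In12 w ⊎ In21 w))

  IsPath : List (Fin N × Fin N) → Set
  IsPath []           = ⊤
  IsPath (u ∷ [])     = Vertex𝒢 u
  IsPath (u ∷ w ∷ vs) = Vertex𝒢 u × Edge𝒢 u w × IsPath (w ∷ vs)

module Submission where

-- The proof is an induction on the common length n of the two words, peeling
-- off the first letters x, y.
--   * If x = y, the first letter lies in the common prefix, so removing it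
--     changes neither the postfixes nor the adjacency (EGn-diag); on the path
--     side the diagonal vertex (x , x) may precede any vertex (IsPath-diag).
--   * If x ≠ y, the postfixes are the whole words. Being "opposed" (types
--     {1,2} and letterwise adjacent) then means that every letter pair lies in
--     V₁₂, or every one in V₂₁ (Opposed-cons).  On the path side, V₁₂ and V₂₁
--     are closed under outgoing edges, so a path starting off the diagonal is
--     a sequence of V₁₂-vertices or of V₂₁-vertices (IsPath-offdiag).

open import Defs
open import Data.Nat using (ℕ; _≥_)
open import Data.Fin using (Fin; _≟_)
open import Data.Vec using (Vec; toList; []; _∷_)
open import Data.List using (List; []; _∷_; zip)
open import Data.List.Properties using (∷-injectiveˡ; ∷-injectiveʳ)
open import Data.List.Relation.Unary.All using (All; []; _∷_)
open import Data.List.Relation.Binary.Pointwise using (Pointwise; []; _∷_)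
open import Data.Bool using (true; false; if_then_else_)
open import Data.Bool.Properties using (¬-not)
open import Data.Product using (_×_; Σ; _,_; proj₁; proj₂)
open import Data.Product.Function.NonDependent.Propositional using (_×-⇔_)
open import Data.Sum using (_⊎_; inj₁; inj₂)
open import Data.Sum.Function.Propositional using (_⊎-⇔_)
open import Data.Unit using (tt)
open import Data.Empty using (⊥; ⊥-elim)
open import Function.Bundles using (_⇔_; mk⇔; Equivalence)
open import Function.Related.Propositional using (module EquationalReasoning)
open import Function.Related.TypeIsomorphisms using (¬-cong-⇔)
import Function.Properties.Equivalence as ⇔
open import Relation.Nullary using (Dec; yes; no)
open import Relation.Binary.PropositionalEquality
  using (_≡_; _≢_; refl; sym; trans; cong)

open Equivalence using (to; from)

Pointwise-split : ∀ {a b r p q} {A : Set a} {B : Set b}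
  {R : A → B → Set r} {P : A → Set p} {Q : B → Set q} {xs : List A} {ys : List B}
  → (All P xs × All Q ys × Pointwise R xs ys)
    ⇔ Pointwise (λ x y → P x × Q y × R x y) xs ys
Pointwise-split = mk⇔ join split
  where
  join : ∀ {xs ys} → All _ xs × All _ ys × Pointwise _ xs ys → Pointwise _ xs ys
  join ([] , [] , []) = []
  join (p ∷ ps , q ∷ qs , r ∷ rs) = (p , q , r) ∷ join (ps , qs , rs)

  split : ∀ {xs ys} → Pointwise _ xs ys → All _ xs × All _ ys × Pointwise _ xs ys
  split [] = [] , [] , []
  split ((p , q , r) ∷ rest) with split rest
  ... | ps , qs , rs = p ∷ ps , q ∷ qs , r ∷ rs

Pointwise-zip : ∀ {a p} {A : Set a} {P : A × A → Set p} {n} (xs ys : Vec A n)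
  → Pointwise (λ x y → P (x , y)) (toList xs) (toList ys)
    ⇔ All P (zip (toList xs) (toList ys))
Pointwise-zip [] [] = mk⇔ (λ _ → []) (λ _ → [])
Pointwise-zip (x ∷ xs) (y ∷ ys) = mk⇔
  (λ { (p ∷ ps) → p ∷ to (Pointwise-zip xs ys) ps })
  (λ { (p ∷ ps) → p ∷ from (Pointwise-zip xs ys) ps })

s₁≢s₂ : s₁ ≢ s₂
s₁≢s₂ ()

sideEq-sound : ∀ a b → sideEq a b ≡ true → a ≡ b
sideEq-sound s₁ s₁ _ = refl
sideEq-sound s₂ s₂ _ = refl

sideEq-refl : ∀ a → sideEq a a ≡ true
sideEq-refl s₁ = refl
sideEq-refl s₂ = refl

if-t₁ : ∀ b₁ b₂ → (if b₁ then t₁ else (if b₂ then t₂ else t₀)) ≡ t₁ ⇔ b₁ ≡ true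
if-t₁ true  _     = mk⇔ (λ _ → refl) (λ _ → refl)
if-t₁ false true  = mk⇔ (λ ()) (λ ())
if-t₁ false false = mk⇔ (λ ()) (λ ())

if-t₂ : ∀ b₁ b₂
  → (if b₁ then t₁ else (if b₂ then t₂ else t₀)) ≡ t₂ ⇔ (b₁ ≡ false × b₂ ≡ true)
if-t₂ true  _     = mk⇔ (λ ()) (λ { (() , _) })
if-t₂ false true  = mk⇔ (λ _ → refl , refl) (λ _ → refl)
if-t₂ false false = mk⇔ (λ ()) (λ { (_ , ()) })

module _ {N : ℕ} (side : Fin N → Side) where

  OnSide : Side → List (Fin N) → Set
  OnSide s = All (λ z → side z ≡ s)

  allIn-OnSide : ∀ s zs → allIn side s zs ≡ true ⇔ OnSide s zs
  allIn-OnSide s [] = mk⇔ (λ _ → []) (λ _ → refl)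
  allIn-OnSide s (z ∷ zs) with sideEq (side z) s in e
  ... | true  = mk⇔ (λ p → sideEq-sound _ _ e ∷ to (allIn-OnSide s zs) p)
                    (λ { (_ ∷ ps) → from (allIn-OnSide s zs) ps })
  ... | false = mk⇔ (λ ())
                    (λ { (refl ∷ _) → ⊥-elim (true≢false (trans (sym (sideEq-refl s)) e)) })
    where
    true≢false : true ≢ false
    true≢false ()

  typ-t₁ : ∀ zs → typ side zs ≡ t₁ ⇔ OnSide s₁ zs
  typ-t₁ zs = ⇔.trans (if-t₁ (allIn side s₁ zs) _) (allIn-OnSide s₁ zs)

  -- A nonempty word has type 2 iff it lies in V₂ (the empty word has type 1).
  typ-t₂ : ∀ z zs → typ side (z ∷ zs) ≡ t₂ ⇔ OnSide s₂ (z ∷ zs)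
  typ-t₂ z zs = mk⇔
    (λ t → to (allIn-OnSide s₂ (z ∷ zs)) (proj₂ (to conditional t)))
    (λ { o@(h ∷ _) → from conditional
          ( ¬-not (λ e → notInV₁ h (to (allIn-OnSide s₁ (z ∷ zs)) e))
          , from (allIn-OnSide s₂ (z ∷ zs)) o ) })
    where
    conditional : typ side (z ∷ zs) ≡ t₂ ⇔ (allIn side s₁ (z ∷ zs) ≡ false × allIn side s₂ (z ∷ zs) ≡ true)
    conditional = if-t₂ (allIn side s₁ (z ∷ zs)) (allIn side s₂ (z ∷ zs))

    notInV₁ : side z ≡ s₂ → OnSide s₁ (z ∷ zs) → ⊥
    notInV₁ h (h′ ∷ _) = s₁≢s₂ (trans (sym h′) h)

lcp-diag : ∀ {N} (x : Fin N) xs ys → lcp (x ∷ xs) (x ∷ ys) ≡ x ∷ lcp xs ys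
lcp-diag x xs ys with x ≟ x
... | yes _ = refl
... | no x≢x = ⊥-elim (x≢x refl)

lcp-offdiag : ∀ {N} {x y : Fin N} xs ys → x ≢ y → lcp (x ∷ xs) (y ∷ ys) ≡ []
lcp-offdiag {x = x} {y} xs ys x≢y with x ≟ y
... | yes x≡y = ⊥-elim (x≢y x≡y)
... | no _ = refl

module _ {N : ℕ} (side : Fin N → Side) (Adj : Fin N → Fin N → Set) where

  Word : Set
  Word = List (Fin N)

  Opposed : Word → Word → Set
  Opposed a b =
    (((typ side a ≡ t₁) × (typ side b ≡ t₂)) ⊎ ((typ side a ≡ t₂) × (typ side b ≡ t₁)))
    × Pointwise Adj a b

  Crossing : Side → Side → Word → Word → Set
  Crossing s t = Pointwise (λ x y → side x ≡ s × side y ≡ t × Adj x y)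

  EGn-diag : ∀ x xs ys → EGn side Adj (x ∷ xs) (x ∷ ys) ⇔ EGn side Adj xs ys
  EGn-diag x xs ys rewrite lcp-diag x xs ys =
    tail≡ ⊎-⇔ (¬-cong-⇔ tail≡ ×-⇔ ⇔.refl)
    where
    tail≡ : x ∷ xs ≡ x ∷ ys ⇔ xs ≡ ys
    tail≡ = mk⇔ ∷-injectiveʳ (cong (x ∷_))

  -- Edges of G_n: with different first letters the postfixes are the words.
  EGn-offdiag : ∀ {x y} xs ys → x ≢ y
    → EGn side Adj (x ∷ xs) (y ∷ ys) ⇔ Opposed (x ∷ xs) (y ∷ ys)
  EGn-offdiag xs ys x≢y rewrite lcp-offdiag xs ys x≢y = mk⇔
    (λ { (inj₁ e) → ⊥-elim (x≢y (∷-injectiveˡ e)) ; (inj₂ (_ , o)) → o })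
    (λ o → inj₂ ((λ e → x≢y (∷-injectiveˡ e)) , o))

  Opposed-cons : ∀ x y xs ys → Opposed (x ∷ xs) (y ∷ ys)
    ⇔ (Crossing s₁ s₂ (x ∷ xs) (y ∷ ys) ⊎ Crossing s₂ s₁ (x ∷ xs) (y ∷ ys))
  Opposed-cons x y xs ys = mk⇔ toCrossing fromCrossing
    where
    Crossings : Set
    Crossings = Crossing s₁ s₂ (x ∷ xs) (y ∷ ys) ⊎ Crossing s₂ s₁ (x ∷ xs) (y ∷ ys)

    toCrossing : Opposed (x ∷ xs) (y ∷ ys) → Crossings
    toCrossing (inj₁ (a , b) , w) =
      inj₁ (to Pointwise-split (to (typ-t₁ side _) a , to (typ-t₂ side y ys) b , w))
    toCrossing (inj₂ (a , b) , w) =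
      inj₂ (to Pointwise-split (to (typ-t₂ side x xs) a , to (typ-t₁ side _) b , w))

    fromCrossing : Crossings → Opposed (x ∷ xs) (y ∷ ys)
    fromCrossing (inj₁ c) with from Pointwise-split c
    ... | a , b , w = inj₁ (from (typ-t₁ side _) a , from (typ-t₂ side y ys) b) , w
    fromCrossing (inj₂ c) with from Pointwise-split c
    ... | a , b , w = inj₂ (from (typ-t₂ side x xs) a , from (typ-t₁ side _) b) , w

  Pair : Set
  Pair = Fin N × Fin N

  Path : List Pair → Set
  Path = IsPath side Adj

  In12-offdiag : ∀ {x y} → In12 side Adj (x , y) → x ≢ y
  In12-offdiag (a , b , _) refl = s₁≢s₂ (trans (sym a) b)

  In21-offdiag : ∀ {x y} → In21 side Adj (x , y) → x ≢ y
  In21-offdiag (a , b , _) refl = s₁≢s₂ (trans (sym b) a)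

  In12∩In21 : ∀ {v} → In12 side Adj v → In21 side Adj v → ⊥
  In12∩In21 (a , _) (b , _) = s₁≢s₂ (trans (sym a) b)

  headVertex : ∀ v vs → Path (v ∷ vs) → Vertex𝒢 side Adj v
  headVertex v []      p = p
  headVertex v (_ ∷ _) p = proj₁ p

  -- A diagonal vertex has an edge to every vertex, so it can head any path.
  IsPath-diag : ∀ x vs → Path ((x , x) ∷ vs) ⇔ Path vs
  IsPath-diag x []      = mk⇔ (λ _ → tt) (λ _ → inj₁ refl)
  IsPath-diag x (w ∷ vs) = mk⇔ (λ p → proj₂ (proj₂ p)) (λ p → inj₁ refl , edge (headVertex w vs p) , p)
    where
    edge : Vertex𝒢 side Adj w → Edge𝒢 side Adj (x , x) w
    edge (inj₁ d) = inj₁ (refl , d)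
    edge (inj₂ o) = inj₂ (inj₂ (inj₂ (refl , o)))

  IsPath-closed : (C : Pair → Set)
    → (∀ {v} → C v → Vertex𝒢 side Adj v)
    → (∀ {u w} → C u → Edge𝒢 side Adj u w → C w)
    → (∀ {u w} → C u → C w → Edge𝒢 side Adj u w)
    → ∀ {v} vs → C v → Path (v ∷ vs) ⇔ All C (v ∷ vs)
  IsPath-closed C vertex closed complete vs c = mk⇔ (stay vs c) (build vs)
    where
    stay : ∀ {v} vs → C v → Path (v ∷ vs) → All C (v ∷ vs)
    stay []       c _             = c ∷ []
    stay (w ∷ vs) c (_ , e , p)   = c ∷ stay vs (closed c e) p

    build : ∀ {v} vs → All C (v ∷ vs) → Path (v ∷ vs)
    build []       (c ∷ [])      = vertex c
    build (w ∷ vs) (c ∷ c′ ∷ cs) = vertex c , complete c c′ , build vs (c′ ∷ cs)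

  edge-from-12 : ∀ {u w} → In12 side Adj u → Edge𝒢 side Adj u w → In12 side Adj w
  edge-from-12 i (inj₁ (d , _))                 = ⊥-elim (In12-offdiag i d)
  edge-from-12 i (inj₂ (inj₁ (_ , j)))          = j
  edge-from-12 i (inj₂ (inj₂ (inj₁ (i′ , _))))  = ⊥-elim (In12∩In21 i i′)
  edge-from-12 i (inj₂ (inj₂ (inj₂ (d , _))))   = ⊥-elim (In12-offdiag i d)

  edge-from-21 : ∀ {u w} → In21 side Adj u → Edge𝒢 side Adj u w → In21 side Adj w
  edge-from-21 i (inj₁ (d , _))                 = ⊥-elim (In21-offdiag i d)
  edge-from-21 i (inj₂ (inj₁ (i′ , _)))         = ⊥-elim (In12∩In21 i′ i)
  edge-from-21 i (inj₂ (inj₂ (inj₁ (_ , j))))   = j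
  edge-from-21 i (inj₂ (inj₂ (inj₂ (d , _))))   = ⊥-elim (In21-offdiag i d)

  IsPath-12 : ∀ {v} vs → In12 side Adj v → Path (v ∷ vs) ⇔ All (In12 side Adj) (v ∷ vs)
  IsPath-12 = IsPath-closed (In12 side Adj) (λ c → inj₂ (inj₁ c)) edge-from-12
                (λ c c′ → inj₂ (inj₁ (c , c′)))

  IsPath-21 : ∀ {v} vs → In21 side Adj v → Path (v ∷ vs) ⇔ All (In21 side Adj) (v ∷ vs)
  IsPath-21 = IsPath-closed (In21 side Adj) (λ c → inj₂ (inj₂ c)) edge-from-21
                (λ c c′ → inj₂ (inj₂ (inj₁ (c , c′))))

  IsPath-offdiag : ∀ {x y} vs → x ≢ y
    → Path ((x , y) ∷ vs) ⇔ (All (In12 side Adj) ((x , y) ∷ vs) ⊎ All (In21 side Adj) ((x , y) ∷ vs))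
  IsPath-offdiag vs x≢y = mk⇔ classify
    λ { (inj₁ a@(c ∷ _)) → from (IsPath-12 vs c) a ; (inj₂ a@(c ∷ _)) → from (IsPath-21 vs c) a }
    where
    classify : Path (_ ∷ vs) → All (In12 side Adj) (_ ∷ vs) ⊎ All (In21 side Adj) (_ ∷ vs)
    classify p with headVertex _ vs p
    ... | inj₁ d        = ⊥-elim (x≢y d)
    ... | inj₂ (inj₁ c) = inj₁ (to (IsPath-12 vs c) p)
    ... | inj₂ (inj₂ c) = inj₂ (to (IsPath-21 vs c) p)

  EGn⇔IsPath : ∀ {n} (xs ys : Vec (Fin N) n)
    → EGn side Adj (toList xs) (toList ys) ⇔ Path (zip (toList xs) (toList ys))
  EGn⇔IsPath []       []       = mk⇔ (λ _ → tt) (λ _ → inj₁ refl)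
  EGn⇔IsPath (x ∷ xs) (y ∷ ys) = byFirstLetters (x ≟ y)
    where
    open EquationalReasoning
    -- Case split on the first letters without abstracting x ≟ y in the goal
    -- (lcp itself branches on it).
    byFirstLetters : Dec (x ≡ y) → EGn side Adj (x ∷ toList xs) (y ∷ toList ys)
                                     ⇔ Path ((x , y) ∷ zip (toList xs) (toList ys))
    byFirstLetters (yes refl) = begin
      EGn side Adj (x ∷ toList xs) (x ∷ toList ys)  ∼⟨ EGn-diag x _ _ ⟩
      EGn side Adj (toList xs) (toList ys)          ∼⟨ EGn⇔IsPath xs ys ⟩
      Path (zip (toList xs) (toList ys))            ∼⟨ ⇔.sym (IsPath-diag x _) ⟩
      Path ((x , x) ∷ zip (toList xs) (toList ys))  ∎
    byFirstLetters (no x≢y) = begin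
      EGn side Adj (x ∷ toList xs) (y ∷ toList ys)  ∼⟨ EGn-offdiag _ _ x≢y ⟩
      Opposed (x ∷ toList xs) (y ∷ toList ys)       ∼⟨ Opposed-cons x y _ _ ⟩
      (Crossing s₁ s₂ (x ∷ toList xs) (y ∷ toList ys) ⊎ Crossing s₂ s₁ (x ∷ toList xs) (y ∷ toList ys))
        ∼⟨ Pointwise-zip (x ∷ xs) (y ∷ ys) ⊎-⇔ Pointwise-zip (x ∷ xs) (y ∷ ys) ⟩
      (All (In12 side Adj) ((x , y) ∷ zip (toList xs) (toList ys))
        ⊎ All (In21 side Adj) ((x , y) ∷ zip (toList xs) (toList ys)))
        ∼⟨ ⇔.sym (IsPath-offdiag _ x≢y) ⟩
      Path ((x , y) ∷ zip (toList xs) (toList ys))  ∎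

mainTheorem1 : (N : ℕ) (side : Fin N → Side) (Adj : Fin N → Fin N → Set)
    → (∀ x y → Adj x y → Adj y x)
    → (∀ x y → Adj x y → side x ≢ side y)
    → Σ (Fin N) (λ x → side x ≡ s₁)
    → Σ (Fin N) (λ y → side y ≡ s₂)
    → (n : ℕ) → n ≥ 1 → (xs ys : Vec (Fin N) n)
    → EGn side Adj (toList xs) (toList ys) ⇔ IsPath side Adj (zip (toList xs) (toList ys))
mainTheorem1 N side Adj _ _ _ _ n _ xs ys = EGn⇔IsPath side Adj xs ys
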